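{- Let $q$ be a prime power and $n\geq 4$ an integer. Let $\Gamma=\Gamma(\mathrm{Alt}_n(\mathbb{F}_q))$ be the alternating bilinear forms graph, and let $\theta_0$ and $\theta_r$ be the largest and the smallest eigenvalue of its adjacency matrix. Then the Hoffman ratio bound for $\Gamma$ coincides with the Singleton-like bound for alternating codes of minimum rank distance $4$, namely $$q^{\frac{n(n-1)}{2}}\cdot\frac{ -\theta_r}{\theta_0-\theta_r}=q^{\frac{n(n-1)}{2\lfloor n/2\rfloor}\left(\lfloor n/2\rfloor-1\right)}.$$
   Context: $\mathrm{Alt}_n(\mathbb{F}_q)$ is the $\mathbb{F}_q$-space of $n\times n$ alternating matrices over $\mathbb{F}_q$ (i.e. $A=-A^\top$ with zero diagonal); it has $q^{n(n-1)/2}$ elements. The alternating bilinear forms graph $\Gamma(\mathrm{Alt}_n(\mathbb{F}_q))$ has vertex set $\mathrm{Alt}_n(\mathbb{F}_q)$, with $A,B$ adjacent iff $\mathrm{rk}(A-B)=2$. Its distinct adjacency eigenvalues are $\theta_x=P^{(n)}(x)=\frac{q^{2n-2x-1}-q^n-q^{n-1}+1}{q^2-1}$ for $x\in\{0,1,\dots,\lfloor n/2\rfloor\}$, with $\theta_0>\theta_1>\dots>\theta_{\lfloor n/2\rfloor}$ (so $r=\lfloor n/2\rfloor$). The Hoffman ratio bound for a regular graph on $N$ vertices with largest eigenvalue $\lambda_1$ and smallest eigenvalue $\lambda_{\min}$ is $N\frac{ -\lambda_{\min}}{\lambda_1-\lambda_{\min}}$. -}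

module Defs where

open import Data.Nat as ℕ using (ℕ; zero; suc; _∸_; _≤_; ⌊_/2⌋; s≤s; z≤n)
open import Data.Nat.Primality using (Prime)
open import Data.Product using (∃; ∃-syntax; _×_)
open import Data.Integer using (+_)
open import Data.Rational using (ℚ; _/_; _+_; _-_; _*_; -_; 0ℚ; _≟_; _÷_; ≢-nonZero)
open import Relation.Nullary using (yes; no)
open import Relation.Binary.PropositionalEquality using (_≡_)

IsPrimePower : ℕ → Set
IsPrimePower q = ∃[ p ] ∃[ k ] (Prime p × q ≡ p ℕ.^ suc k)

⟦_⟧ : ℕ → ℚ
⟦ m ⟧ = (+ m) / 1

-- total division on ℚ (x ÷ 0 := 0); only ever applied to nonzero denominators here
_÷'_ : ℚ → ℚ → ℚ
x ÷' y with y ≟ 0ℚ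
... | yes _ = 0ℚ
... | no y≢0 = _÷_ x y {{≢-nonZero y≢0}}

-- r = ⌊n/2⌋, the diameter / index of the smallest eigenvalue
r : ℕ → ℕ
r n = ⌊ n /2⌋

θ : (q n x : ℕ) → ℚ
θ q n x =
  (⟦ q ℕ.^ (2 ℕ.* n ∸ 2 ℕ.* x ∸ 1) ⟧ - ⟦ q ℕ.^ n ⟧ - ⟦ q ℕ.^ (n ∸ 1) ⟧ + ⟦ 1 ⟧)
    ÷' (⟦ q ℕ.^ 2 ⟧ - ⟦ 1 ⟧)

numVertices : (q n : ℕ) → ℕ
numVertices q n = q ℕ.^ ((n ℕ.* (n ∸ 1)) ℕ./ 2)

hoffmanBound : (N : ℕ) (λ₁ λmin : ℚ) → ℚ
hoffmanBound N λ₁ λmin = (⟦ N ⟧ * (- λmin)) ÷' (λ₁ - λmin)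

-- exponent of the Singleton-like bound: n(n-1)/(2⌊n/2⌋) · (⌊n/2⌋ - 1)
-- (the division is exact; 2⌊n/2⌋ ≠ 0 since n ≥ 4)
singletonExponent : (n : ℕ) → 4 ≤ n → ℕ
singletonExponent zero ()
singletonExponent (suc zero) (s≤s ())
singletonExponent (suc (suc k)) _ =
  ((n ℕ.* (n ∸ 1)) ℕ./ (2 ℕ.* ⌊ n /2⌋)) ℕ.* (⌊ n /2⌋ ∸ 1)
  where n = suc (suc k)

-- Write e = 2n − 2⌊n/2⌋ − 1 and f = 2⌊n/2⌋; according to the parity of n, {e, f} = {n − 1, n}.
-- Then (q² − 1)θ₀ = q^(e+f) − q^n − q^(n−1) + 1 and (q² − 1)θ_r = q^e − q^n − q^(n−1) + 1 = 1 − q^f,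
-- so θ₀ − θ_r and −θ_r are in the ratio q^e(q^f − 1) : (q^f − 1), and the ratio bound is
-- q^(n(n−1)/2) / q^e.  As n(n−1) = e f = 2e⌊n/2⌋, we get n(n−1)/(2⌊n/2⌋) = e and
-- n(n−1)/2 − e = e(⌊n/2⌋ − 1), which is the Singleton-like exponent.
module Submission where

open import Defs
open import Data.Nat using (ℕ; _≤_; _^_)
open import Relation.Binary.PropositionalEquality using (_≡_)

open import Data.Nat as ℕ using (_<_; _∸_; z<s)
open import Data.Nat.Properties as ℕ using (+-comm; ^-monoʳ-<)
open import Data.Rational as ℚ using (ℚ; 0ℚ; 1ℚ)
import Data.Rational.Properties as ℚ
open import Data.Product using (_,_)
open import Relation.Binary.PropositionalEquality using (_≢_; refl; sym; trans; cong; module ≡-Reasoning)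

module RatioBound where
  open import Data.Nat.Properties using (^-distribˡ-+-*)
  import Data.Nat.Coprimality as Coprimality
  open import Data.Integer using (+_)
  import Data.Integer.Properties as ℤ
  open import Data.Rational using (_+_; _-_; _*_; -_; 1/_; ↥_; mkℚ; toℚᵘ; _≟_; ≢-nonZero)
  open import Data.Rational.Properties
    using (*-assoc; *-identityˡ; *-identityʳ; *-zeroʳ; *-inverseˡ; *-inverseʳ; +-identityˡ; 1≢0
          ; toℚᵘ-injective; toℚᵘ-homo-*; normalize-coprime)
  open import Data.Rational.Unnormalised.Base using (mkℚᵘ) renaming (_*_ to _*ᵘ_)
  import Data.Rational.Unnormalised.Properties as ℚᵘ
  open import Data.Rational.Solver using (module +-*-Solver)
  open import Data.Empty using (⊥-elim)
  open import Relation.Nullary using (yes; no)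
  open import Relation.Binary.PropositionalEquality using (cong₂; subst)
  open ≡-Reasoning

  x*y≢0 : ∀ {x y} → x ≢ 0ℚ → y ≢ 0ℚ → x * y ≢ 0ℚ
  x*y≢0 {x} {y} x≢0 y≢0 xy≡0 = y≢0 (begin
    y              ≡⟨ sym (*-identityˡ y) ⟩
    1ℚ * y         ≡⟨ cong (_* y) (sym (*-inverseˡ x {{≢-nonZero x≢0}})) ⟩
    x⁻¹ * x * y    ≡⟨ *-assoc x⁻¹ x y ⟩
    x⁻¹ * (x * y)  ≡⟨ cong (x⁻¹ *_) xy≡0 ⟩
    x⁻¹ * 0ℚ       ≡⟨ *-zeroʳ x⁻¹ ⟩
    0ℚ             ∎)
    where x⁻¹ = (1/ x) {{≢-nonZero x≢0}}

  x⁻¹≢0 : ∀ {x} (x≢0 : x ≢ 0ℚ) → (1/ x) {{≢-nonZero x≢0}} ≢ 0ℚ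
  x⁻¹≢0 {x} x≢0 x⁻¹≡0 = 1≢0 (begin
    1ℚ       ≡⟨ sym (*-inverseʳ x {{≢-nonZero x≢0}}) ⟩
    x * x⁻¹  ≡⟨ cong (x *_) x⁻¹≡0 ⟩
    x * 0ℚ   ≡⟨ *-zeroʳ x ⟩
    0ℚ       ∎)
    where x⁻¹ = (1/ x) {{≢-nonZero x≢0}}

  ÷'-≡-*-1/ : ∀ x {y} (y≢0 : y ≢ 0ℚ) → x ÷' y ≡ x * (1/ y) {{≢-nonZero y≢0}}
  ÷'-≡-*-1/ x {y} y≢0 with y ≟ 0ℚ
  ... | yes y≡0 = ⊥-elim (y≢0 y≡0)
  ... | no _    = refl

  ÷'-unique : ∀ {x y z} → y ≢ 0ℚ → z * y ≡ x → x ÷' y ≡ z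
  ÷'-unique {x} {y} {z} y≢0 zy≡x = begin
    x ÷' y         ≡⟨ ÷'-≡-*-1/ x y≢0 ⟩
    x * y⁻¹        ≡⟨ cong (_* y⁻¹) (sym zy≡x) ⟩
    z * y * y⁻¹    ≡⟨ *-assoc z y y⁻¹ ⟩
    z * (y * y⁻¹)  ≡⟨ cong (z *_) (*-inverseʳ y {{≢-nonZero y≢0}}) ⟩
    z * 1ℚ         ≡⟨ *-identityʳ z ⟩
    z              ∎
    where y⁻¹ = (1/ y) {{≢-nonZero y≢0}}

  ÷'-*-cancel : ∀ x {y} → y ≢ 0ℚ → (x ÷' y) * y ≡ x
  ÷'-*-cancel x {y} y≢0 = begin
    (x ÷' y) * y   ≡⟨ cong (_* y) (÷'-≡-*-1/ x y≢0) ⟩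
    x * y⁻¹ * y    ≡⟨ *-assoc x y⁻¹ y ⟩
    x * (y⁻¹ * y)  ≡⟨ cong (x *_) (*-inverseˡ y {{≢-nonZero y≢0}}) ⟩
    x * 1ℚ         ≡⟨ *-identityʳ x ⟩
    x              ∎
    where y⁻¹ = (1/ y) {{≢-nonZero y≢0}}

  hoffmanBound-* : ∀ N {λ₁ λmin c} → c ≢ 0ℚ → λ₁ - λmin ≢ 0ℚ →
    hoffmanBound N (λ₁ * c) (λmin * c) ≡ hoffmanBound N λ₁ λmin
  hoffmanBound-* N {λ₁} {λmin} {c} c≢0 gap≢0 = ÷'-unique scaledGap≢0 (begin
    h * (λ₁ * c - λmin * c)  ≡⟨ solve 4 (λ h x y c → h :* (x :* c :- y :* c) := h :* (x :- y) :* c) refl h λ₁ λmin c ⟩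
    h * (λ₁ - λmin) * c      ≡⟨ cong (_* c) (÷'-*-cancel (⟦ N ⟧ * - λmin) gap≢0) ⟩
    ⟦ N ⟧ * - λmin * c       ≡⟨ solve 3 (λ n y c → n :* (:- y) :* c := n :* (:- (y :* c))) refl ⟦ N ⟧ λmin c ⟩
    ⟦ N ⟧ * - (λmin * c)     ∎)
    where
    open +-*-Solver using (solve; _:=_; _:-_; _:*_; :-_)
    h = hoffmanBound N λ₁ λmin
    scaledGap≢0 : λ₁ * c - λmin * c ≢ 0ℚ
    scaledGap≢0 = subst (_≢ 0ℚ)
      (solve 3 (λ x y c → (x :- y) :* c := x :* c :- y :* c) refl λ₁ λmin c)
      (x*y≢0 gap≢0 c≢0)

  hoffmanBound-÷' : ∀ N {λ₁ λmin Q} → Q ≢ 0ℚ → λ₁ - λmin ≢ 0ℚ →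
    hoffmanBound N (λ₁ ÷' Q) (λmin ÷' Q) ≡ hoffmanBound N λ₁ λmin
  hoffmanBound-÷' N {λ₁} {λmin} {Q} Q≢0 gap≢0 = begin
    hoffmanBound N (λ₁ ÷' Q) (λmin ÷' Q)    ≡⟨ cong₂ (hoffmanBound N) (÷'-≡-*-1/ λ₁ Q≢0) (÷'-≡-*-1/ λmin Q≢0) ⟩
    hoffmanBound N (λ₁ * Q⁻¹) (λmin * Q⁻¹)  ≡⟨ hoffmanBound-* N {λ₁} {λmin} (x⁻¹≢0 Q≢0) gap≢0 ⟩
    hoffmanBound N λ₁ λmin                  ∎
    where Q⁻¹ = (1/ Q) {{≢-nonZero Q≢0}}

  module _ {B C E F : ℚ} where
    open +-*-Solver using (solve; _:=_; _:+_; _:-_; _:*_; :-_; con)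

    numerator-gap : ∀ {P} → P ≡ E * F → (P - B - C + 1ℚ) - (E - B - C + 1ℚ) ≡ E * (F - 1ℚ)
    numerator-gap refl =
      solve 4 (λ b c e f → (e :* f :- b :- c :+ con 1ℚ) :- (e :- b :- c :+ con 1ℚ) := e :* (f :- con 1ℚ)) refl B C E F

    numerator-neg : E + F ≡ B + C → - (E - B - C + 1ℚ) ≡ F - 1ℚ
    numerator-neg E+F≡B+C = begin
      - (E - B - C + 1ℚ)  ≡⟨ solve 4 (λ b c e f → :- (e :- b :- c :+ con 1ℚ) := (b :+ c) :- e :- con 1ℚ) refl B C E F ⟩
      (B + C) - E - 1ℚ    ≡⟨ cong (λ s → s - E - 1ℚ) (sym E+F≡B+C) ⟩
      (E + F) - E - 1ℚ    ≡⟨ solve 2 (λ e f → (e :+ f) :- e :- con 1ℚ := f :- con 1ℚ) refl E F ⟩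
      F - 1ℚ              ∎

    hoffmanBound-numerators : ∀ N T {P Q} → Q ≢ 0ℚ → E ≢ 0ℚ → F - 1ℚ ≢ 0ℚ →
      P ≡ E * F → E + F ≡ B + C → ⟦ N ⟧ ≡ E * ⟦ T ⟧ →
      hoffmanBound N ((P - B - C + 1ℚ) ÷' Q) ((E - B - C + 1ℚ) ÷' Q) ≡ ⟦ T ⟧
    hoffmanBound-numerators N T {P} Q≢0 E≢0 F-1≢0 P≡EF E+F≡B+C N≡ET =
      trans (hoffmanBound-÷' N Q≢0 gap≢0) (÷'-unique gap≢0 (begin
        ⟦ T ⟧ * (X - Y)         ≡⟨ cong (⟦ T ⟧ *_) (numerator-gap P≡EF) ⟩
        ⟦ T ⟧ * (E * (F - 1ℚ))  ≡⟨ solve 3 (λ t e g → t :* (e :* g) := e :* t :* g) refl ⟦ T ⟧ E (F - 1ℚ) ⟩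
        E * ⟦ T ⟧ * (F - 1ℚ)    ≡⟨ cong (_* (F - 1ℚ)) (sym N≡ET) ⟩
        ⟦ N ⟧ * (F - 1ℚ)        ≡⟨ cong (⟦ N ⟧ *_) (sym (numerator-neg E+F≡B+C)) ⟩
        ⟦ N ⟧ * - Y             ∎))
      where
      X = P - B - C + 1ℚ
      Y = E - B - C + 1ℚ
      gap≢0 : X - Y ≢ 0ℚ
      gap≢0 = subst (_≢ 0ℚ) (sym (numerator-gap P≡EF)) (x*y≢0 E≢0 F-1≢0)

  ⟦⟧≡mkℚ : ∀ m → ⟦ m ⟧ ≡ mkℚ (+ m) 0 (Coprimality.sym (Coprimality.1-coprimeTo m))
  ⟦⟧≡mkℚ m = normalize-coprime _

  ⟦⟧-injective : ∀ {m n} → ⟦ m ⟧ ≡ ⟦ n ⟧ → m ≡ n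
  ⟦⟧-injective {m} {n} eq = ℤ.+-injective (begin
    + m      ≡⟨ cong ↥_ (sym (⟦⟧≡mkℚ m)) ⟩
    ↥ ⟦ m ⟧  ≡⟨ cong ↥_ eq ⟩
    ↥ ⟦ n ⟧  ≡⟨ cong ↥_ (⟦⟧≡mkℚ n) ⟩
    + n      ∎)

  ⟦⟧-* : ∀ m n → ⟦ m ℕ.* n ⟧ ≡ ⟦ m ⟧ * ⟦ n ⟧
  ⟦⟧-* m n = toℚᵘ-injective (ℚᵘ.≃-trans (ℚᵘ.≃-reflexive toℚᵘ-eq) (ℚᵘ.≃-sym (toℚᵘ-homo-* ⟦ m ⟧ ⟦ n ⟧)))
    where
    toℚᵘ-eq : toℚᵘ ⟦ m ℕ.* n ⟧ ≡ toℚᵘ ⟦ m ⟧ *ᵘ toℚᵘ ⟦ n ⟧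
    toℚᵘ-eq rewrite ⟦⟧≡mkℚ (m ℕ.* n) | ⟦⟧≡mkℚ m | ⟦⟧≡mkℚ n = cong (λ i → mkℚᵘ i 0) (ℤ.pos-* m n)

  ⟦⟧-^-+ : ∀ q a b → ⟦ q ^ (a ℕ.+ b) ⟧ ≡ ⟦ q ^ a ⟧ * ⟦ q ^ b ⟧
  ⟦⟧-^-+ q a b = trans (cong ⟦_⟧ (^-distribˡ-+-* q a b)) (⟦⟧-* (q ^ a) (q ^ b))

  ⟦⟧≢0 : ∀ {m} → 0 < m → ⟦ m ⟧ ≢ 0ℚ
  ⟦⟧≢0 0<m eq = ℕ.<⇒≢ 0<m (sym (⟦⟧-injective eq))

  ⟦⟧-1≢0 : ∀ {m} → 1 < m → ⟦ m ⟧ - 1ℚ ≢ 0ℚ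
  ⟦⟧-1≢0 {m} 1<m eq = ℕ.<⇒≢ 1<m (sym (⟦⟧-injective (begin
    ⟦ m ⟧            ≡⟨ solve 1 (λ x → x := x :- con 1ℚ :+ con 1ℚ) refl ⟦ m ⟧ ⟩
    ⟦ m ⟧ - 1ℚ + 1ℚ  ≡⟨ cong (_+ 1ℚ) eq ⟩
    0ℚ + 1ℚ          ≡⟨ +-identityˡ 1ℚ ⟩
    1ℚ               ∎)))
    where open +-*-Solver using (solve; _:=_; _:+_; _:-_; con)

module Exponents where
  open import Data.Nat using (zero; suc; _+_; _*_; _/_; ⌊_/2⌋; s≤s; nonTrivial⇒n>1)
  open import Data.Nat.Primality using (prime⇒nonTrivial)
  open import Data.Nat.Properties using (*-comm; *-assoc; +-suc; +-identityʳ; *-suc; m+n∸n≡m)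
  open import Data.Nat.DivMod using (m*n/n≡m)
  open import Data.Product using (_,′_)
  open import Data.Sum using (_⊎_; inj₁; inj₂)
  open import Relation.Binary.PropositionalEquality using (cong₂)
  open ≡-Reasoning

  swap-invariant : ∀ {A B : Set} (g : A → A → B) → (∀ x y → g x y ≡ g y x) →
    ∀ {x y u v} → (x ,′ y) ≡ (u ,′ v) ⊎ (x ,′ y) ≡ (v ,′ u) → g x y ≡ g u v
  swap-invariant g comm (inj₁ refl) = refl
  swap-invariant g comm (inj₂ refl) = comm _ _

  half-parity : ∀ n → n ≡ ⌊ n /2⌋ + ⌊ n /2⌋ ⊎ n ≡ suc (⌊ n /2⌋ + ⌊ n /2⌋)
  half-parity zero = inj₁ refl
  half-parity (suc zero) = inj₂ refl
  half-parity (suc (suc n)) with half-parity n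
  ... | inj₁ even = inj₁ (cong suc (trans (cong suc even) (sym (+-suc _ _))))
  ... | inj₂ odd  = inj₂ (cong suc (trans (cong suc odd) (cong suc (sym (+-suc _ _)))))

  θ-exponent : ℕ → ℕ → ℕ
  θ-exponent n x = 2 * n ∸ 2 * x ∸ 1

  θ-exponent-0 : ∀ n → θ-exponent n 0 ≡ n + (n ∸ 1)
  θ-exponent-0 zero    = refl
  θ-exponent-0 (suc m) = trans (cong (m +_) (+-identityʳ (suc m))) (+-suc m m)

  2*m≡m+m : ∀ m → 2 * m ≡ m + m
  2*m≡m+m m = cong (m +_) (+-identityʳ m)

  θ-exponent-r : ∀ n →
    (θ-exponent n (r n) ,′ 2 * r n) ≡ (n ,′ n ∸ 1) ⊎ (θ-exponent n (r n) ,′ 2 * r n) ≡ (n ∸ 1 ,′ n)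
  θ-exponent-r n with half-parity n
  ... | inj₁ even = inj₂ (even-case {h = ⌊ n /2⌋} even)
    where
    even-case : ∀ {n h} → n ≡ h + h → (θ-exponent n h ,′ 2 * h) ≡ (n ∸ 1 ,′ n)
    even-case {h = h} refl = cong₂ _,′_ (cong (_∸ 1) (begin
      2 * (h + h) ∸ 2 * h          ≡⟨ cong₂ _∸_ (2*m≡m+m (h + h)) (2*m≡m+m h) ⟩
      (h + h) + (h + h) ∸ (h + h)  ≡⟨ m+n∸n≡m (h + h) (h + h) ⟩
      h + h                        ∎)) (2*m≡m+m h)
  ... | inj₂ odd = inj₁ (odd-case {h = ⌊ n /2⌋} odd)
    where
    odd-case : ∀ {n h} → n ≡ suc (h + h) → (θ-exponent n h ,′ 2 * h) ≡ (n ,′ n ∸ 1)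
    odd-case {h = h} refl = cong₂ _,′_ (cong (_∸ 1) (begin
      2 * suc (h + h) ∸ 2 * h                ≡⟨ cong₂ _∸_ (2*m≡m+m (suc (h + h))) (2*m≡m+m h) ⟩
      suc (h + h) + suc (h + h) ∸ (h + h)    ≡⟨ cong (_∸ (h + h)) (cong suc (+-suc (h + h) (h + h))) ⟩
      suc (suc (h + h)) + (h + h) ∸ (h + h)  ≡⟨ m+n∸n≡m (suc (suc (h + h))) (h + h) ⟩
      suc (suc (h + h))                      ∎)) (2*m≡m+m h)

  numVertices-exponent : ∀ n (4≤n : 4 ≤ n) →
    n * (n ∸ 1) / 2 ≡ θ-exponent n (r n) + singletonExponent n 4≤n
  numVertices-exponent (suc (suc k)) _ = begin
    n * (n ∸ 1) / 2                      ≡⟨ cong (_/ 2) n[n-1]≡e*2h ⟩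
    e * (2 * h) / 2                      ≡⟨ cong (_/ 2) (trans (cong (e *_) (*-comm 2 h)) (sym (*-assoc e h 2))) ⟩
    e * h * 2 / 2                        ≡⟨ m*n/n≡m (e * h) 2 ⟩
    e * h                                ≡⟨ *-suc e (h ∸ 1) ⟩  -- h = r (2 + k) reduces to suc (r k)
    e + e * (h ∸ 1)                      ≡⟨ cong (λ d → e + d * (h ∸ 1)) (sym n[n-1]/2h≡e) ⟩
    e + n * (n ∸ 1) / (2 * h) * (h ∸ 1)  ∎
    where
    n = suc (suc k)
    h = r n
    e = θ-exponent n h
    n[n-1]≡e*2h : n * (n ∸ 1) ≡ e * (2 * h)
    n[n-1]≡e*2h = sym (swap-invariant _*_ *-comm (θ-exponent-r n))
    n[n-1]/2h≡e : n * (n ∸ 1) / (2 * h) ≡ e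
    n[n-1]/2h≡e = trans (cong (_/ (2 * h)) n[n-1]≡e*2h) (m*n/n≡m e (2 * h))
  numVertices-exponent (suc zero) (s≤s ())

  0<2*r : ∀ {n} → 2 ≤ n → 0 < 2 * r n
  0<2*r {suc (suc n)} _ = z<s
  0<2*r {suc zero} (s≤s ())

  primePower>1 : ∀ {q} → IsPrimePower q → 1 < q
  primePower>1 (p , k , p-prime , refl) = ^-monoʳ-< p (nonTrivial⇒n>1 p {{prime⇒nonTrivial p-prime}}) {0} {suc k} z<s

open RatioBound
open Exponents

proposition3p15 : (q n : ℕ) → IsPrimePower q → (h : 4 ≤ n) →
    hoffmanBound (numVertices q n) (θ q n 0) (θ q n (r n))
      ≡ ⟦ q ^ singletonExponent n h ⟧
proposition3p15 q n q-prime-power 4≤n =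
  hoffmanBound-numerators (numVertices q n) (q ^ s) Q≢0 E≢0 F-1≢0 P≡EF E+F≡B+C N≡ET
  where
  1<q = primePower>1 q-prime-power
  e = θ-exponent n (r n)
  f = 2 ℕ.* r n
  s = singletonExponent n 4≤n
  ⟦q^_⟧ : ℕ → ℚ
  ⟦q^ k ⟧ = ⟦ q ^ k ⟧
  Q≢0 : ⟦q^ 2 ⟧ ℚ.- 1ℚ ≢ 0ℚ
  Q≢0 = ⟦⟧-1≢0 (^-monoʳ-< q 1<q {0} {2} z<s)
  E≢0 : ⟦q^ e ⟧ ≢ 0ℚ
  E≢0 = ⟦⟧≢0 (ℕ.m^n>0 q {{ℕ.>-nonZero (ℕ.<-trans z<s 1<q)}} e)
  F-1≢0 : ⟦q^ f ⟧ ℚ.- 1ℚ ≢ 0ℚ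
  F-1≢0 = ⟦⟧-1≢0 (^-monoʳ-< q 1<q (0<2*r (ℕ.≤-trans (ℕ.m≤m+n 2 2) 4≤n)))
  P≡EF : ⟦q^ θ-exponent n 0 ⟧ ≡ ⟦q^ e ⟧ ℚ.* ⟦q^ f ⟧
  P≡EF = trans (cong ⟦q^_⟧ (trans (θ-exponent-0 n) (sym (swap-invariant ℕ._+_ +-comm (θ-exponent-r n)))))
               (⟦⟧-^-+ q e f)
  E+F≡B+C : ⟦q^ e ⟧ ℚ.+ ⟦q^ f ⟧ ≡ ⟦q^ n ⟧ ℚ.+ ⟦q^ (n ∸ 1) ⟧
  E+F≡B+C = swap-invariant (λ a b → ⟦q^ a ⟧ ℚ.+ ⟦q^ b ⟧) (λ a b → ℚ.+-comm ⟦q^ a ⟧ ⟦q^ b ⟧) (θ-exponent-r n)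
  N≡ET : ⟦ numVertices q n ⟧ ≡ ⟦q^ e ⟧ ℚ.* ⟦q^ s ⟧
  N≡ET = trans (cong ⟦q^_⟧ (numVertices-exponent n 4≤n)) (⟦⟧-^-+ q e s)
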